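{- For any derivation $\mathcal{D}$ in normal form witnessing $\vdash_{\mathsf{GT}^- }\Gamma \Rightarrow \Delta$, each formula occurring in $\mathcal{D}$ is a partial resolution or a subformula of a resolution of some formula occurring in $\Gamma,\Delta$.
   Context: Classical formulas: $\alpha::=p\mid\bot\mid\neg\alpha\mid\alpha\wedge\alpha\mid\alpha\vee\alpha$; formulas of $\mathbf{PL}(\mathbin{\backslash\!\!\!/})$: $\phi::=\alpha\mid\phi\wedge\phi\mid\phi\vee\phi\mid\phi\mathbin{\backslash\!\!\!/}\phi$ ($\vee$ split disjunction, $\mathbin{\backslash\!\!\!/}$ inquisitive disjunction). $\mathsf{GT}^-$ is the cut-free calculus ($\alpha$ classical, $\Lambda$ a multiset of classical formulas) with axioms $\Gamma,p\Rightarrow p,\Delta$, $\Gamma,\bot\Rightarrow\Delta$ and rules $\mathsf{L}\neg$ ($\Gamma\Rightarrow\alpha,\Delta$ / $\Gamma,\neg\alpha\Rightarrow\Delta$), $\mathsf{R}\neg$ ($\Gamma,\alpha\Rightarrow\Delta$ / $\Gamma\Rightarrow\neg\alpha,\Delta$), $\mathsf{L}\wedge$, $\mathsf{R}\wedge$ ($\Gamma\Rightarrow\phi,\Lambda$ and $\Gamma\Rightarrow\psi,\Lambda$ / $\Gamma\Rightarrow\phi\wedge\psi,\Lambda,\Delta$), $\mathsf{L}\vee$ ($\Gamma,\phi\Rightarrow\Lambda$ and $\Gamma,\psi\Rightarrow\Lambda$ / $\Gamma,\phi\vee\psi\Rightarrow\Lambda,\Delta$), $\mathsf{R}\vee$,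 $\mathsf{L}\mathbin{\backslash\!\!\!/}$ ($\Gamma,\chi\{\phi_L\}\Rightarrow\Delta$ and $\Gamma,\chi\{\phi_R\}\Rightarrow\Delta$ / $\Gamma,\chi\{\phi_L\mathbin{\backslash\!\!\!/}\phi_R\}\Rightarrow\Delta$), $\mathsf{R}\mathbin{\backslash\!\!\!/}$ ($\Gamma\Rightarrow\chi\{\phi_i\},\Delta$ / $\Gamma\Rightarrow\chi\{\phi_L\mathbin{\backslash\!\!\!/}\phi_R\},\Delta$), where $\chi\{\eta\}$ replaces a fixed subformula occurrence of $\chi$ not in the scope of a negation by $\eta$; $\mathsf{G3cp}^-$ is $\mathsf{GT}^-$ without the two $\mathbin{\backslash\!\!\!/}$ rules. Resolutions: $\mathcal{R}(p)=\{p\}$, $\mathcal{R}(\bot)=\{\bot\}$, $\mathcal{R}(\neg\alpha)=\{\neg\beta\mid\beta\in\mathcal{R}(\alpha)\}$, $\mathcal{R}(\phi\circ\psi)=\{\alpha\circ\beta\mid\alpha\in\mathcal{R}(\phi),\beta\in\mathcal{R}(\psi)\}$ for $\circ\in\{\wedge,\vee\}$, $\mathcal{R}(\phi\mathbin{\backslash\!\!\!/}\psi)=\mathcal{R}(\phi)\cup\mathcal{R}(\psi)$; $\mathcal{R}(\Gamma)$ is the set of multisets obtained by replacing each member of $\Gamma$ by one of its resolutions. Partial resolutions of $\phi$: label the occurrences of $\mathbin{\backslash\!\!\!/}$ in $\phi$ from left to right by $0,\dots,|\phi|-1$; $\phi[i/j]$ ($i\in\{L,R\}$) replaces the occurrence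 $\chi_L\mathbin{\backslash\!\!\!/}_j\chi_R$ by $\chi_i$; the partial resolutions are all results of finitely many such substitutions at distinct labels (including none). A derivation of $\Gamma\Rightarrow\Delta$ is in normal form if, for some $f:\mathcal{R}(\Gamma)\to\mathcal{R}(\Delta)$, it first derives each $\Xi\Rightarrow f(\Xi)$ ($\Xi\in\mathcal{R}(\Gamma)$) using only $\mathsf{G3cp}^-$ rules, then each $\Xi\Rightarrow\Delta$ using only $\mathsf{R}\mathbin{\backslash\!\!\!/}$, then $\Gamma\Rightarrow\Delta$ using only $\mathsf{L}\mathbin{\backslash\!\!\!/}$. -}

module Defs where

open import Data.Nat using (ℕ; zero; suc; _+_; _<_)
open import Data.Nat.Properties using (_≟_)
open import Data.List using (List; []; _∷_; _++_; map; foldr; cartesianProductWith)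
open import Data.List.Membership.Propositional using (_∈_)
open import Data.List.Relation.Unary.All using (All)
open import Data.List.Relation.Unary.Unique.Propositional using (Unique)
open import Data.List.Relation.Binary.Pointwise using (Pointwise)
open import Data.List.Relation.Binary.Permutation.Propositional using (_↭_)
open import Data.Product using (Σ; _×_; _,_; proj₁; proj₂)
open import Data.Sum using (_⊎_)
open import Data.Empty using (⊥)
open import Data.Unit using (⊤)
open import Relation.Nullary using (yes; no)
open import Relation.Binary.PropositionalEquality using (_≡_)

-- Atoms are natural numbers.
--   or  = split disjunction  ∨
--   ior = inquisitive disjunction ⩔
-- Negation is only allowed on classical formulas: this is enforced by
-- the well-formedness predicate WF below.

data Fm : Set where
  at  : ℕ → Fm
  bot : Fm
  neg : Fm → Fm
  and : Fm → Fm → Fm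
  or  : Fm → Fm → Fm
  ior : Fm → Fm → Fm

data Classical : Fm → Set where
  at  : ∀ p → Classical (at p)
  bot : Classical bot
  neg : ∀ {α} → Classical α → Classical (neg α)
  and : ∀ {α β} → Classical α → Classical β → Classical (and α β)
  or  : ∀ {α β} → Classical α → Classical β → Classical (or α β)

data WF : Fm → Set where
  at  : ∀ p → WF (at p)
  bot : WF bot
  neg : ∀ {α} → Classical α → WF (neg α)
  and : ∀ {φ ψ} → WF φ → WF ψ → WF (and φ ψ)
  or  : ∀ {φ ψ} → WF φ → WF ψ → WF (or φ ψ)
  ior : ∀ {φ ψ} → WF φ → WF ψ → WF (ior φ ψ)

data Side : Set where
  L R : Side

pick : {A : Set} → Side → A → A → A
pick L x y = x
pick R x y = y

data Ctx : Set where
  hole : Ctx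
  andL : Ctx → Fm → Ctx
  andR : Fm → Ctx → Ctx
  orL  : Ctx → Fm → Ctx
  orR  : Fm → Ctx → Ctx
  iorL : Ctx → Fm → Ctx
  iorR : Fm → Ctx → Ctx

plug : Ctx → Fm → Fm
plug hole η = η
plug (andL c ψ) η = and (plug c η) ψ
plug (andR φ c) η = and φ (plug c η)
plug (orL c ψ) η = or (plug c η) ψ
plug (orR φ c) η = or φ (plug c η)
plug (iorL c ψ) η = ior (plug c η) ψ
plug (iorR φ c) η = ior φ (plug c η)

Res : Fm → List Fm
Res (at p) = at p ∷ []
Res bot = bot ∷ []
Res (neg α) = map neg (Res α)
Res (and φ ψ) = cartesianProductWith and (Res φ) (Res ψ)
Res (or φ ψ) = cartesianProductWith or (Res φ) (Res ψ)
Res (ior φ ψ) = Res φ ++ Res ψ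

-- Ξ ∈ R(Γ) for multisets represented as lists (up to permutation):
-- Ξ is a permutation of a list obtained by replacing each member of Γ
-- by one of its resolutions.
ResM : List Fm → List Fm → Set
ResM Γ Ξ = Σ (List Fm) λ Ξ₀ → Pointwise (λ φ ξ → ξ ∈ Res φ) Γ Ξ₀ × (Ξ ↭ Ξ₀)

data _≼_ : Fm → Fm → Set where
  here  : ∀ {φ} → φ ≼ φ
  negS  : ∀ {φ α} → φ ≼ α → φ ≼ neg α
  andSL : ∀ {φ ψ χ} → φ ≼ ψ → φ ≼ and ψ χ
  andSR : ∀ {φ ψ χ} → φ ≼ χ → φ ≼ and ψ χ
  orSL  : ∀ {φ ψ χ} → φ ≼ ψ → φ ≼ or ψ χ
  orSR  : ∀ {φ ψ χ} → φ ≼ χ → φ ≼ or ψ χ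
  iorSL : ∀ {φ ψ χ} → φ ≼ ψ → φ ≼ ior ψ χ
  iorSR : ∀ {φ ψ χ} → φ ≼ χ → φ ≼ ior ψ χ

-- Partial resolutions, via labelled occurrences of ⩔

data LFm : Set where
  lat  : ℕ → LFm
  lbot : LFm
  lneg : LFm → LFm
  land : LFm → LFm → LFm
  lor  : LFm → LFm → LFm
  lior : ℕ → LFm → LFm → LFm

iorCount : Fm → ℕ
iorCount (at p) = 0
iorCount bot = 0
iorCount (neg φ) = iorCount φ
iorCount (and φ ψ) = iorCount φ + iorCount ψ
iorCount (or φ ψ) = iorCount φ + iorCount ψ
iorCount (ior φ ψ) = suc (iorCount φ + iorCount ψ)

labelFrom : ℕ → Fm → LFm × ℕ
labelFrom n (at p) = lat p , n
labelFrom n bot = lbot , n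
labelFrom n (neg φ) with labelFrom n φ
... | l , m = lneg l , m
labelFrom n (and φ ψ) with labelFrom n φ
... | l , m with labelFrom m ψ
... | r , k = land l r , k
labelFrom n (or φ ψ) with labelFrom n φ
... | l , m with labelFrom m ψ
... | r , k = lor l r , k
labelFrom n (ior φ ψ) with labelFrom n φ
... | l , m with labelFrom (suc m) ψ
... | r , k = lior m l r , k

label : Fm → LFm
label φ = proj₁ (labelFrom 0 φ)

erase : LFm → Fm
erase (lat p) = at p
erase lbot = bot
erase (lneg l) = neg (erase l)
erase (land l r) = and (erase l) (erase r)
erase (lor l r) = or (erase l) (erase r)
erase (lior _ l r) = ior (erase l) (erase r)

subst : Side → ℕ → LFm → LFm
subst i j (lat p) = lat p
subst i j lbot = lbot
subst i j (lneg l) = lneg (subst i j l)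
subst i j (land l r) = land (subst i j l) (subst i j r)
subst i j (lor l r) = lor (subst i j l) (subst i j r)
subst i j (lior k l r) with j ≟ k
... | yes _ = pick i l r
... | no _ = lior k (subst i j l) (subst i j r)

substAll : List (Side × ℕ) → LFm → LFm
substAll σ l = foldr (λ s acc → subst (proj₁ s) (proj₂ s) acc) l σ

PartialRes : Fm → Fm → Set
PartialRes φ ψ =
  Σ (List (Side × ℕ)) λ σ →
    Unique (map proj₂ σ) × All (λ j → j < iorCount ψ) (map proj₂ σ)
    × erase (substAll σ (label ψ)) ≡ φ

-- The calculus GT⁻ (sequents are lists, read as multisets: every
-- conclusion is taken up to permutation of both sides).

infix 4 _⊢_

data _⊢_ : List Fm → List Fm → Set where
  axP : ∀ {Γ Δ Γ' Δ'} p → Γ' ↭ at p ∷ Γ → Δ' ↭ at p ∷ Δ → Γ' ⊢ Δ'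
  axB : ∀ {Γ Γ' Δ} → Γ' ↭ bot ∷ Γ → Γ' ⊢ Δ
  L¬  : ∀ {Γ Γ' Δ} α → Classical α → Γ ⊢ α ∷ Δ → Γ' ↭ neg α ∷ Γ → Γ' ⊢ Δ
  R¬  : ∀ {Γ Δ Δ'} α → Classical α → α ∷ Γ ⊢ Δ → Δ' ↭ neg α ∷ Δ → Γ ⊢ Δ'
  L∧  : ∀ {Γ Γ' Δ} φ ψ → φ ∷ ψ ∷ Γ ⊢ Δ → Γ' ↭ and φ ψ ∷ Γ → Γ' ⊢ Δ
  R∧  : ∀ {Γ Δ Δ'} φ ψ Λ → All Classical Λ → Γ ⊢ φ ∷ Λ → Γ ⊢ ψ ∷ Λ →
        Δ' ↭ and φ ψ ∷ Λ ++ Δ → Γ ⊢ Δ'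
  L∨  : ∀ {Γ Γ' Δ Δ'} φ ψ Λ → All Classical Λ → φ ∷ Γ ⊢ Λ → ψ ∷ Γ ⊢ Λ →
        Γ' ↭ or φ ψ ∷ Γ → Δ' ↭ Λ ++ Δ → Γ' ⊢ Δ'
  R∨  : ∀ {Γ Δ Δ'} φ ψ → Γ ⊢ φ ∷ ψ ∷ Δ → Δ' ↭ or φ ψ ∷ Δ → Γ ⊢ Δ'
  L⩔  : ∀ {Γ Γ' Δ} χ φL φR → plug χ φL ∷ Γ ⊢ Δ → plug χ φR ∷ Γ ⊢ Δ →
        Γ' ↭ plug χ (ior φL φR) ∷ Γ → Γ' ⊢ Δ
  R⩔  : ∀ {Γ Δ Δ'} χ φL φR (i : Side) → Γ ⊢ plug χ (pick i φL φR) ∷ Δ →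
        Δ' ↭ plug χ (ior φL φR) ∷ Δ → Γ ⊢ Δ'

G3 : ∀ {Γ Δ} → Γ ⊢ Δ → Set
G3 (axP _ _ _) = ⊤
G3 (axB _) = ⊤
G3 (L¬ _ _ d _) = G3 d
G3 (R¬ _ _ d _) = G3 d
G3 (L∧ _ _ d _) = G3 d
G3 (R∧ _ _ _ _ d e _) = G3 d × G3 e
G3 (L∨ _ _ _ _ d e _ _) = G3 d × G3 e
G3 (R∨ _ _ d _) = G3 d
G3 (L⩔ _ _ _ _ _ _) = ⊥
G3 (R⩔ _ _ _ _ _ _) = ⊥

mutual
  Occurs : ∀ {Γ Δ} → Fm → Γ ⊢ Δ → Set
  Occurs {Γ} {Δ} φ d = φ ∈ Γ ++ Δ ⊎ OccursAbove φ d

  OccursAbove : ∀ {Γ Δ} → Fm → Γ ⊢ Δ → Set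
  OccursAbove φ (axP _ _ _) = ⊥
  OccursAbove φ (axB _) = ⊥
  OccursAbove φ (L¬ _ _ d _) = Occurs φ d
  OccursAbove φ (R¬ _ _ d _) = Occurs φ d
  OccursAbove φ (L∧ _ _ d _) = Occurs φ d
  OccursAbove φ (R∧ _ _ _ _ d e _) = Occurs φ d ⊎ Occurs φ e
  OccursAbove φ (L∨ _ _ _ _ d e _ _) = Occurs φ d ⊎ Occurs φ e
  OccursAbove φ (R∨ _ _ d _) = Occurs φ d
  OccursAbove φ (L⩔ _ _ _ d e _) = Occurs φ d ⊎ Occurs φ e
  OccursAbove φ (R⩔ _ _ _ _ d _) = Occurs φ d

module NF (Γ₀ Δ₀ : List Fm) (f : List Fm → List Fm) where

  data RBlock {Ξ : List Fm} : ∀ {Θ} → Ξ ⊢ Θ → Set where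
    rstop : ∀ {Θ} (d : Ξ ⊢ Θ) → G3 d → Θ ↭ f Ξ → RBlock d
    rstep : ∀ {Δ Δ'} χ φL φR i (d : Ξ ⊢ plug χ (pick i φL φR) ∷ Δ)
            (p : Δ' ↭ plug χ (ior φL φR) ∷ Δ) →
            RBlock d → RBlock (R⩔ χ φL φR i d p)

  data LBlock : ∀ {Γ} → Γ ⊢ Δ₀ → Set where
    lstop : ∀ {Ξ} (d : Ξ ⊢ Δ₀) → ResM Γ₀ Ξ → RBlock d → LBlock d
    lstep : ∀ {Γ Γ'} χ φL φR (d : plug χ φL ∷ Γ ⊢ Δ₀) (e : plug χ φR ∷ Γ ⊢ Δ₀)
            (p : Γ' ↭ plug χ (ior φL φR) ∷ Γ) →
            LBlock d → LBlock e → LBlock (L⩔ χ φL φR d e p)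

-- f : R(Γ) → R(Δ), a function on multisets (respects permutation)
NormalForm : ∀ {Γ Δ} → Γ ⊢ Δ → Set
NormalForm {Γ} {Δ} d =
  Σ (List Fm → List Fm) λ f →
    (∀ Ξ → ResM Γ Ξ → ResM Δ (f Ξ))
    × (∀ Ξ Ξ' → ResM Γ Ξ → Ξ ↭ Ξ' → f Ξ ↭ f Ξ')
    × NF.LBlock Γ Δ f d

{-# OPTIONS --safe #-}
-- Read upwards, the L⩔-block of a normal-form derivation resolves ⩔'s only inside
-- antecedent formulas and the R⩔-block only inside succedent formulas, so every
-- formula there is a partial resolution of a member of Γ or Δ.  The G3cp⁻-derivations
-- on top end in sequents Ξ ⇒ f(Ξ) built from resolutions of Γ and Δ, and by the
-- subformula property every formula in them is a subformula of such a resolution.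
--
-- That partial resolutions are closed under resolving one more ⩔ is the delicate
-- part: labelling assigns the occurrences of ⩔ strictly increasing labels from left
-- to right, so the occurrence to be resolved carries a label that occurs exactly once
-- and has not been substituted before.
module Submission where

open import Defs
open import Data.List using (List; []; _∷_; _++_; map)
open import Data.List.Membership.Propositional using (_∈_)
open import Data.List.Membership.Propositional.Properties using (∈-++⁺ˡ; ∈-++⁺ʳ; ∈-++⁻)
open import Data.List.Relation.Unary.All using (All; []; _∷_)
import Data.List.Relation.Unary.All as All
open import Data.List.Relation.Unary.Any using (here; there)
open import Data.List.Relation.Unary.Unique.Propositional using (Unique)
open import Data.List.Relation.Unary.AllPairs using ([]; _∷_)
open import Data.List.Relation.Binary.Pointwise using (Pointwise; _∷_)
import Data.List.Relation.Binary.Pointwise as Pointwise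
open import Data.List.Relation.Binary.Subset.Propositional using (_⊆_)
open import Data.List.Relation.Binary.Subset.Propositional.Properties
  using (⊆-trans; ⊆-reflexive-↭; xs⊆xs++ys; xs⊆ys++xs)
open import Data.List.Relation.Binary.Permutation.Propositional using (_↭_; ↭-sym; ↭-trans)
import Data.List.Relation.Binary.Permutation.Propositional.Properties as ↭
open import Data.Product using (Σ; _×_; _,_; proj₁; proj₂)
open import Data.Sum using (_⊎_; inj₁; inj₂)
open import Data.Empty using (⊥-elim)
open import Data.Nat using (ℕ; suc; _+_; _≤_; _<_)
open import Data.Nat.Properties
  using (_≟_; ≟-diag; ≤-refl; ≤-trans; <⇒≤; <⇒≢; <-≤-trans; <-irrefl; m≤m+n; n≤1+n; +-identityʳ; +-assoc; +-suc)
open import Function using (_∘_)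
open import Relation.Nullary using (¬_; yes; no)
open import Relation.Nullary.Decidable using (dec-no)
open import Relation.Binary.PropositionalEquality using (_≡_; _≢_; refl; sym; trans; cong; cong₂)

data Ordered : ℕ → ℕ → LFm → Set where
  lat  : ∀ {lo hi p} → lo ≤ hi → Ordered lo hi (lat p)
  lbot : ∀ {lo hi} → lo ≤ hi → Ordered lo hi lbot
  lneg : ∀ {lo hi l} → Ordered lo hi l → Ordered lo hi (lneg l)
  land : ∀ {lo m hi l r} → Ordered lo m l → Ordered m hi r → Ordered lo hi (land l r)
  lor  : ∀ {lo m hi l r} → Ordered lo m l → Ordered m hi r → Ordered lo hi (lor l r)
  lior : ∀ {lo k hi l r} → Ordered lo k l → Ordered (suc k) hi r → Ordered lo hi (lior k l r)

data HasLabel (j : ℕ) : LFm → Set where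
  root : ∀ {l r} → HasLabel j (lior j l r)
  neg  : ∀ {l} → HasLabel j l → HasLabel j (lneg l)
  andˡ : ∀ {l r} → HasLabel j l → HasLabel j (land l r)
  andʳ : ∀ {l r} → HasLabel j r → HasLabel j (land l r)
  orˡ  : ∀ {l r} → HasLabel j l → HasLabel j (lor l r)
  orʳ  : ∀ {l r} → HasLabel j r → HasLabel j (lor l r)
  iorˡ : ∀ {k l r} → HasLabel j l → HasLabel j (lior k l r)
  iorʳ : ∀ {k l r} → HasLabel j r → HasLabel j (lior k l r)

Ordered⇒≤ : ∀ {lo hi M} → Ordered lo hi M → lo ≤ hi
Ordered⇒≤ (lat lo≤hi) = lo≤hi
Ordered⇒≤ (lbot lo≤hi) = lo≤hi
Ordered⇒≤ (lneg o) = Ordered⇒≤ o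
Ordered⇒≤ (land o o′) = ≤-trans (Ordered⇒≤ o) (Ordered⇒≤ o′)
Ordered⇒≤ (lor o o′) = ≤-trans (Ordered⇒≤ o) (Ordered⇒≤ o′)
Ordered⇒≤ (lior o o′) = ≤-trans (Ordered⇒≤ o) (<⇒≤ (Ordered⇒≤ o′))

Ordered-widen : ∀ {lo hi lo′ hi′ M} → lo′ ≤ lo → hi ≤ hi′ → Ordered lo hi M → Ordered lo′ hi′ M
Ordered-widen p q (lat lo≤hi) = lat (≤-trans p (≤-trans lo≤hi q))
Ordered-widen p q (lbot lo≤hi) = lbot (≤-trans p (≤-trans lo≤hi q))
Ordered-widen p q (lneg o) = lneg (Ordered-widen p q o)
Ordered-widen p q (land o o′) = land (Ordered-widen p ≤-refl o) (Ordered-widen ≤-refl q o′)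
Ordered-widen p q (lor o o′) = lor (Ordered-widen p ≤-refl o) (Ordered-widen ≤-refl q o′)
Ordered-widen p q (lior o o′) = lior (Ordered-widen p ≤-refl o) (Ordered-widen ≤-refl q o′)

HasLabel-bounds : ∀ {lo hi M j} → Ordered lo hi M → HasLabel j M → lo ≤ j × j < hi
HasLabel-bounds (lneg o) (neg h) = HasLabel-bounds o h
HasLabel-bounds (land o o′) (andˡ h) with HasLabel-bounds o h
... | lo≤j , j<m = lo≤j , <-≤-trans j<m (Ordered⇒≤ o′)
HasLabel-bounds (land o o′) (andʳ h) with HasLabel-bounds o′ h
... | m≤j , j<hi = ≤-trans (Ordered⇒≤ o) m≤j , j<hi
HasLabel-bounds (lor o o′) (orˡ h) with HasLabel-bounds o h
... | lo≤j , j<m = lo≤j , <-≤-trans j<m (Ordered⇒≤ o′)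
HasLabel-bounds (lor o o′) (orʳ h) with HasLabel-bounds o′ h
... | m≤j , j<hi = ≤-trans (Ordered⇒≤ o) m≤j , j<hi
HasLabel-bounds (lior o o′) root = Ordered⇒≤ o , Ordered⇒≤ o′
HasLabel-bounds (lior o o′) (iorˡ h) with HasLabel-bounds o h
... | lo≤j , j<k = lo≤j , <-≤-trans j<k (≤-trans (n≤1+n _) (Ordered⇒≤ o′))
HasLabel-bounds (lior o o′) (iorʳ h) with HasLabel-bounds o′ h
... | k<j , j<hi = ≤-trans (Ordered⇒≤ o) (<⇒≤ k<j) , j<hi

HasLabel-disjoint : ∀ {lo m m′ hi l r j} → Ordered lo m l → Ordered m′ hi r → m ≤ m′ →
                    HasLabel j l → ¬ HasLabel j r
HasLabel-disjoint o o′ m≤m′ h h′ =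
  <-irrefl refl (<-≤-trans (proj₂ (HasLabel-bounds o h)) (≤-trans m≤m′ (proj₁ (HasLabel-bounds o′ h′))))

subst-here : ∀ i k l r → subst i k (lior k l r) ≡ pick i l r
subst-here i k l r rewrite ≟-diag (refl {x = k}) = refl

subst-lior : ∀ {i j k l r} → j ≢ k → subst i j (lior k l r) ≡ lior k (subst i j l) (subst i j r)
subst-lior {j = j} {k} j≢k rewrite dec-no (j ≟ k) j≢k = refl

subst-fresh : ∀ i {j} M → ¬ HasLabel j M → subst i j M ≡ M
subst-fresh i (lat p) _ = refl
subst-fresh i lbot _ = refl
subst-fresh i (lneg l) ∉ = cong lneg (subst-fresh i l (∉ ∘ neg))
subst-fresh i (land l r) ∉ = cong₂ land (subst-fresh i l (∉ ∘ andˡ)) (subst-fresh i r (∉ ∘ andʳ))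
subst-fresh i (lor l r) ∉ = cong₂ lor (subst-fresh i l (∉ ∘ orˡ)) (subst-fresh i r (∉ ∘ orʳ))
subst-fresh i {j} (lior k l r) ∉ with j ≟ k
... | yes refl = ⊥-elim (∉ root)
... | no _ = cong₂ (lior k) (subst-fresh i l (∉ ∘ iorˡ)) (subst-fresh i r (∉ ∘ iorʳ))

Ordered-subst : ∀ {lo hi M} i j → Ordered lo hi M → Ordered lo hi (subst i j M)
Ordered-subst i j (lat lo≤hi) = lat lo≤hi
Ordered-subst i j (lbot lo≤hi) = lbot lo≤hi
Ordered-subst i j (lneg o) = lneg (Ordered-subst i j o)
Ordered-subst i j (land o o′) = land (Ordered-subst i j o) (Ordered-subst i j o′)
Ordered-subst i j (lor o o′) = lor (Ordered-subst i j o) (Ordered-subst i j o′)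
Ordered-subst i j (lior {k = k} o o′) with j ≟ k
Ordered-subst L j (lior o o′) | yes _ = Ordered-widen ≤-refl (<⇒≤ (Ordered⇒≤ o′)) o
Ordered-subst R j (lior o o′) | yes _ = Ordered-widen (≤-trans (Ordered⇒≤ o) (n≤1+n _)) ≤-refl o′
... | no _ = lior (Ordered-subst i j o) (Ordered-subst i j o′)

HasLabel-subst⁻ : ∀ {k} i j M → HasLabel k (subst i j M) → HasLabel k M
HasLabel-subst⁻ i j (lneg l) (neg h) = neg (HasLabel-subst⁻ i j l h)
HasLabel-subst⁻ i j (land l r) (andˡ h) = andˡ (HasLabel-subst⁻ i j l h)
HasLabel-subst⁻ i j (land l r) (andʳ h) = andʳ (HasLabel-subst⁻ i j r h)
HasLabel-subst⁻ i j (lor l r) (orˡ h) = orˡ (HasLabel-subst⁻ i j l h)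
HasLabel-subst⁻ i j (lor l r) (orʳ h) = orʳ (HasLabel-subst⁻ i j r h)
HasLabel-subst⁻ i j (lior k l r) h with j ≟ k
HasLabel-subst⁻ L j (lior k l r) h | yes _ = iorˡ h
HasLabel-subst⁻ R j (lior k l r) h | yes _ = iorʳ h
HasLabel-subst⁻ i j (lior k l r) root | no _ = root
HasLabel-subst⁻ i j (lior k l r) (iorˡ h) | no _ = iorˡ (HasLabel-subst⁻ i j l h)
HasLabel-subst⁻ i j (lior k l r) (iorʳ h) | no _ = iorʳ (HasLabel-subst⁻ i j r h)

subst-eliminates : ∀ {lo hi M} i j → Ordered lo hi M → ¬ HasLabel j (subst i j M)
subst-eliminates i j (lneg o) (neg h) = subst-eliminates i j o h
subst-eliminates i j (land o o′) (andˡ h) = subst-eliminates i j o h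
subst-eliminates i j (land o o′) (andʳ h) = subst-eliminates i j o′ h
subst-eliminates i j (lor o o′) (orˡ h) = subst-eliminates i j o h
subst-eliminates i j (lor o o′) (orʳ h) = subst-eliminates i j o′ h
subst-eliminates i j (lior {k = k} o o′) h with j ≟ k
subst-eliminates L j (lior o o′) h | yes refl = <-irrefl refl (proj₂ (HasLabel-bounds o h))
subst-eliminates R j (lior o o′) h | yes refl = <-irrefl refl (proj₁ (HasLabel-bounds o′ h))
subst-eliminates i j (lior o o′) root | no j≢j = j≢j refl
subst-eliminates i j (lior o o′) (iorˡ h) | no _ = subst-eliminates i j o h
subst-eliminates i j (lior o o′) (iorʳ h) | no _ = subst-eliminates i j o′ h

and-injective : ∀ {φ ψ φ′ ψ′ : Fm} → and φ ψ ≡ and φ′ ψ′ → φ ≡ φ′ × ψ ≡ ψ′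
and-injective refl = refl , refl

or-injective : ∀ {φ ψ φ′ ψ′ : Fm} → or φ ψ ≡ or φ′ ψ′ → φ ≡ φ′ × ψ ≡ ψ′
or-injective refl = refl , refl

ior-injective : ∀ {φ ψ φ′ ψ′ : Fm} → ior φ ψ ≡ ior φ′ ψ′ → φ ≡ φ′ × ψ ≡ ψ′
ior-injective refl = refl , refl

erase-pick : ∀ i l r → erase (pick i l r) ≡ pick i (erase l) (erase r)
erase-pick L l r = refl
erase-pick R l r = refl

erase-subst-fresh : ∀ i {j} M {φ} → ¬ HasLabel j M → erase M ≡ φ → erase (subst i j M) ≡ φ
erase-subst-fresh i M ∉ e = trans (cong erase (subst-fresh i M ∉)) e

-- Since labels are distinct, substituting at the label of the occurrence
-- under χ touches nothing else.
subst-resolves : ∀ {lo hi M φL φR} χ i → Ordered lo hi M → erase M ≡ plug χ (ior φL φR) →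
                 Σ ℕ λ j → HasLabel j M × erase (subst i j M) ≡ plug χ (pick i φL φR)
subst-resolves hole i (lior {k = k} {l = l} {r = r} _ _) e with ior-injective e
... | refl , refl = k , root , trans (cong erase (subst-here i k l r)) (erase-pick i l r)
subst-resolves (andL χ ψ) i (land {r = r} o o′) e with and-injective e
... | e₁ , e₂ with subst-resolves χ i o e₁
... | j , h , e′ = j , andˡ h , cong₂ and e′ (erase-subst-fresh i r (HasLabel-disjoint o o′ ≤-refl h) e₂)
subst-resolves (andR ψ χ) i (land {l = l} o o′) e with and-injective e
... | e₁ , e₂ with subst-resolves χ i o′ e₂
... | j , h , e′ =
  j , andʳ h , cong₂ and (erase-subst-fresh i l (λ h′ → HasLabel-disjoint o o′ ≤-refl h′ h) e₁) e′
subst-resolves (orL χ ψ) i (lor {r = r} o o′) e with or-injective e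
... | e₁ , e₂ with subst-resolves χ i o e₁
... | j , h , e′ = j , orˡ h , cong₂ or e′ (erase-subst-fresh i r (HasLabel-disjoint o o′ ≤-refl h) e₂)
subst-resolves (orR ψ χ) i (lor {l = l} o o′) e with or-injective e
... | e₁ , e₂ with subst-resolves χ i o′ e₂
... | j , h , e′ =
  j , orʳ h , cong₂ or (erase-subst-fresh i l (λ h′ → HasLabel-disjoint o o′ ≤-refl h′ h) e₁) e′
subst-resolves (iorL χ ψ) i (lior {r = r} o o′) e with ior-injective e
... | e₁ , e₂ with subst-resolves χ i o e₁
... | j , h , e′ = j , iorˡ h ,
  trans (cong erase (subst-lior (<⇒≢ (proj₂ (HasLabel-bounds o h)))))
        (cong₂ ior e′ (erase-subst-fresh i r (HasLabel-disjoint o o′ (n≤1+n _) h) e₂))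
subst-resolves (iorR ψ χ) i (lior {l = l} o o′) e with ior-injective e
... | e₁ , e₂ with subst-resolves χ i o′ e₂
... | j , h , e′ = j , iorʳ h ,
  trans (cong erase (subst-lior (<⇒≢ (proj₁ (HasLabel-bounds o′ h)) ∘ sym)))
        (cong₂ ior (erase-subst-fresh i l (λ h′ → HasLabel-disjoint o o′ (n≤1+n _) h′ h) e₁) e′)

Ordered-cast : ∀ {lo hi hi′ M} → hi ≡ hi′ → Ordered lo hi M → Ordered lo hi′ M
Ordered-cast refl o = o

labelFrom-spec : ∀ n φ →
  Ordered n (n + iorCount φ) (proj₁ (labelFrom n φ)) × erase (proj₁ (labelFrom n φ)) ≡ φ
  × proj₂ (labelFrom n φ) ≡ n + iorCount φ
labelFrom-spec n (at p) = lat (m≤m+n n 0) , refl , sym (+-identityʳ n)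
labelFrom-spec n bot = lbot (m≤m+n n 0) , refl , sym (+-identityʳ n)
labelFrom-spec n (neg φ) with labelFrom n φ | labelFrom-spec n φ
... | _ , _ | o , e , next = lneg o , cong neg e , next
labelFrom-spec n (and φ ψ) with labelFrom n φ | labelFrom-spec n φ
... | _ , ._ | o , e , refl with labelFrom (n + iorCount φ) ψ | labelFrom-spec (n + iorCount φ) ψ
... | _ , ._ | o′ , e′ , refl =
  land o (Ordered-cast (+-assoc n _ _) o′) , cong₂ and e e′ , +-assoc n (iorCount φ) (iorCount ψ)
labelFrom-spec n (or φ ψ) with labelFrom n φ | labelFrom-spec n φ
... | _ , ._ | o , e , refl with labelFrom (n + iorCount φ) ψ | labelFrom-spec (n + iorCount φ) ψ
... | _ , ._ | o′ , e′ , refl =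
  lor o (Ordered-cast (+-assoc n _ _) o′) , cong₂ or e e′ , +-assoc n (iorCount φ) (iorCount ψ)
labelFrom-spec n (ior φ ψ) with labelFrom n φ | labelFrom-spec n φ
... | _ , ._ | o , e , refl with labelFrom (suc (n + iorCount φ)) ψ | labelFrom-spec (suc (n + iorCount φ)) ψ
... | _ , ._ | o′ , e′ , refl = lior o (Ordered-cast next o′) , cong₂ ior e e′ , next
  where next = trans (cong suc (+-assoc n (iorCount φ) (iorCount ψ))) (sym (+-suc n _))

-- A partial resolution together with the invariants that let one more ⩔ be resolved.
record PartialRes⁺ (θ ψ : Fm) : Set where
  field
    choices  : List (Side × ℕ)
    unique   : Unique (map proj₂ choices)
    bounded  : All (_< iorCount ψ) (map proj₂ choices)
    ordered  : Ordered 0 (iorCount ψ) (substAll choices (label ψ))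
    consumed : ∀ {k} → k ∈ map proj₂ choices → ¬ HasLabel k (substAll choices (label ψ))
    erases   : erase (substAll choices (label ψ)) ≡ θ

PartialRes⁺⇒PartialRes : ∀ {θ ψ} → PartialRes⁺ θ ψ → PartialRes θ ψ
PartialRes⁺⇒PartialRes p = choices , unique , bounded , erases
  where open PartialRes⁺ p

PartialRes⁺-refl : ∀ ψ → PartialRes⁺ ψ ψ
PartialRes⁺-refl ψ = record
  { choices  = []
  ; unique   = []
  ; bounded  = []
  ; ordered  = proj₁ (labelFrom-spec 0 ψ)
  ; consumed = λ ()
  ; erases   = proj₁ (proj₂ (labelFrom-spec 0 ψ))
  }

PartialRes⁺-resolve : ∀ {ψ φL φR} χ i → PartialRes⁺ (plug χ (ior φL φR)) ψ →
                      PartialRes⁺ (plug χ (pick i φL φR)) ψ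
PartialRes⁺-resolve χ i p =
  let j , h , e = subst-resolves χ i ordered erases in record
    { choices  = (i , j) ∷ choices
    ; unique   = All.tabulate (λ { k∈ refl → consumed k∈ h }) ∷ unique
    ; bounded  = proj₂ (HasLabel-bounds ordered h) ∷ bounded
    ; ordered  = Ordered-subst i j ordered
    ; consumed = λ { (here refl) → subst-eliminates i j ordered
                   ; (there k∈) → consumed k∈ ∘ HasLabel-subst⁻ i j _ }
    ; erases   = e
    }
  where open PartialRes⁺ p

≼-trans : ∀ {φ ψ θ} → φ ≼ ψ → ψ ≼ θ → φ ≼ θ
≼-trans p here = p
≼-trans p (negS q) = negS (≼-trans p q)
≼-trans p (andSL q) = andSL (≼-trans p q)
≼-trans p (andSR q) = andSR (≼-trans p q)
≼-trans p (orSL q) = orSL (≼-trans p q)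
≼-trans p (orSR q) = orSR (≼-trans p q)
≼-trans p (iorSL q) = iorSL (≼-trans p q)
≼-trans p (iorSR q) = iorSR (≼-trans p q)

Sub : Fm → List Fm → Set
Sub φ T = Σ Fm λ θ → θ ∈ T × φ ≼ θ

infix 4 _⊑_

_⊑_ : List Fm → List Fm → Set
S ⊑ T = ∀ {θ} → θ ∈ S → Sub θ T

Sub-⊑ : ∀ {φ S T} → S ⊑ T → Sub φ S → Sub φ T
Sub-⊑ S⊑T (θ , θ∈S , φ≼θ) with S⊑T θ∈S
... | θ′ , θ′∈T , θ≼θ′ = θ′ , θ′∈T , ≼-trans φ≼θ θ≼θ′

⊆⇒⊑ : ∀ {S T} → S ⊆ T → S ⊑ T
⊆⇒⊑ S⊆T θ∈S = _ , S⊆T θ∈S , here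

∷-⊑ : ∀ {θ S T} → Sub θ T → S ⊑ T → θ ∷ S ⊑ T
∷-⊑ s _ (here refl) = s
∷-⊑ _ S⊑T (there θ∈S) = S⊑T θ∈S

++-⊑ : ∀ {A B T} → A ⊑ T → B ⊑ T → A ++ B ⊑ T
++-⊑ {A} A⊑T B⊑T θ∈ with ∈-++⁻ A θ∈
... | inj₁ θ∈A = A⊑T θ∈A
... | inj₂ θ∈B = B⊑T θ∈B

principalˡ : ∀ {π θ Γ Γ′ Δ} → Γ′ ↭ π ∷ Γ → θ ≼ π → Sub θ (Γ′ ++ Δ)
principalˡ p θ≼π = _ , ∈-++⁺ˡ (↭.∈-resp-↭ (↭-sym p) (here refl)) , θ≼π

principalʳ : ∀ {π θ Γ Δ Δ′} → Δ′ ↭ π ∷ Δ → θ ≼ π → Sub θ (Γ ++ Δ′)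
principalʳ {Γ = Γ} p θ≼π = _ , ∈-++⁺ʳ Γ (↭.∈-resp-↭ (↭-sym p) (here refl)) , θ≼π

contextˡ : ∀ {π : Fm} {Γ Γ′ Δ} → Γ′ ↭ π ∷ Γ → Γ ⊆ Γ′ ++ Δ
contextˡ p θ∈Γ = ∈-++⁺ˡ (↭.∈-resp-↭ (↭-sym p) (there θ∈Γ))

contextʳ : ∀ {π : Fm} {Γ Δ Δ′} → Δ′ ↭ π ∷ Δ → Δ ⊆ Γ ++ Δ′
contextʳ {Γ = Γ} p θ∈Δ = ∈-++⁺ʳ Γ (↭.∈-resp-↭ (↭-sym p) (there θ∈Δ))

L¬-premise : ∀ {α Γ Γ′ Δ} → Γ′ ↭ neg α ∷ Γ → Γ ++ α ∷ Δ ⊑ Γ′ ++ Δ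
L¬-premise {Γ′ = Γ′} {Δ} p =
  ++-⊑ (⊆⇒⊑ (contextˡ p)) (∷-⊑ (principalˡ p (negS here)) (⊆⇒⊑ (xs⊆ys++xs Δ Γ′)))

R¬-premise : ∀ {α Γ Δ Δ′} → Δ′ ↭ neg α ∷ Δ → α ∷ Γ ++ Δ ⊑ Γ ++ Δ′
R¬-premise {Γ = Γ} {Δ′ = Δ′} p =
  ∷-⊑ (principalʳ p (negS here)) (++-⊑ (⊆⇒⊑ (xs⊆xs++ys Γ Δ′)) (⊆⇒⊑ (contextʳ p)))

L∧-premise : ∀ {φ ψ Γ Γ′ Δ} → Γ′ ↭ and φ ψ ∷ Γ → φ ∷ ψ ∷ Γ ++ Δ ⊑ Γ′ ++ Δ
L∧-premise {Γ′ = Γ′} {Δ} p =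
  ∷-⊑ (principalˡ p (andSL here)) (∷-⊑ (principalˡ p (andSR here))
    (++-⊑ (⊆⇒⊑ (contextˡ p)) (⊆⇒⊑ (xs⊆ys++xs Δ Γ′))))

R∧-premise : ∀ {π θ Γ Λ Δ Δ′} → Δ′ ↭ π ∷ Λ ++ Δ → θ ≼ π → Γ ++ θ ∷ Λ ⊑ Γ ++ Δ′
R∧-premise {Γ = Γ} {Λ} {Δ} {Δ′} p θ≼π =
  ++-⊑ (⊆⇒⊑ (xs⊆xs++ys Γ Δ′)) (∷-⊑ (principalʳ p θ≼π) (⊆⇒⊑ (⊆-trans (xs⊆xs++ys Λ Δ) (contextʳ p))))

L∨-premise : ∀ {π θ Γ Γ′ Λ Δ Δ′} → Γ′ ↭ π ∷ Γ → Δ′ ↭ Λ ++ Δ → θ ≼ π → θ ∷ Γ ++ Λ ⊑ Γ′ ++ Δ′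
L∨-premise {Γ′ = Γ′} {Λ} {Δ} p q θ≼π =
  ∷-⊑ (principalˡ p θ≼π) (++-⊑ (⊆⇒⊑ (contextˡ p))
    (⊆⇒⊑ (⊆-trans (xs⊆xs++ys Λ Δ) (⊆-trans (⊆-reflexive-↭ (↭-sym q)) (xs⊆ys++xs _ Γ′)))))

R∨-premise : ∀ {φ ψ Γ Δ Δ′} → Δ′ ↭ or φ ψ ∷ Δ → Γ ++ φ ∷ ψ ∷ Δ ⊑ Γ ++ Δ′
R∨-premise {Γ = Γ} {Δ′ = Δ′} p =
  ++-⊑ (⊆⇒⊑ (xs⊆xs++ys Γ Δ′))
    (∷-⊑ (principalʳ p (orSL here)) (∷-⊑ (principalʳ p (orSR here)) (⊆⇒⊑ (contextʳ p))))

G3-subformula : ∀ {Γ Δ φ} (d : Γ ⊢ Δ) → G3 d → Occurs φ d → Sub φ (Γ ++ Δ)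
G3-subformula d _ (inj₁ φ∈) = _ , φ∈ , here
G3-subformula (L¬ _ _ d p) g (inj₂ o) = Sub-⊑ (L¬-premise p) (G3-subformula d g o)
G3-subformula (R¬ _ _ d p) g (inj₂ o) = Sub-⊑ (R¬-premise p) (G3-subformula d g o)
G3-subformula (L∧ _ _ d p) g (inj₂ o) = Sub-⊑ (L∧-premise p) (G3-subformula d g o)
G3-subformula (R∧ _ _ _ _ d _ p) (g , _) (inj₂ (inj₁ o)) =
  Sub-⊑ (R∧-premise p (andSL here)) (G3-subformula d g o)
G3-subformula (R∧ _ _ _ _ _ e p) (_ , g) (inj₂ (inj₂ o)) =
  Sub-⊑ (R∧-premise p (andSR here)) (G3-subformula e g o)
G3-subformula (L∨ _ _ _ _ d _ p q) (g , _) (inj₂ (inj₁ o)) =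
  Sub-⊑ (L∨-premise p q (orSL here)) (G3-subformula d g o)
G3-subformula (L∨ _ _ _ _ _ e p q) (_ , g) (inj₂ (inj₂ o)) =
  Sub-⊑ (L∨-premise p q (orSR here)) (G3-subformula e g o)
G3-subformula (R∨ _ _ d p) g (inj₂ o) = Sub-⊑ (R∨-premise p) (G3-subformula d g o)

Pointwise-∈ʳ : ∀ {Γ Ξ θ} → Pointwise (λ φ ξ → ξ ∈ Res φ) Γ Ξ → θ ∈ Ξ → Σ Fm λ ψ → ψ ∈ Γ × θ ∈ Res ψ
Pointwise-∈ʳ (θ∈ψ ∷ _) (here refl) = _ , here refl , θ∈ψ
Pointwise-∈ʳ (_ ∷ pw) (there θ∈Ξ) with Pointwise-∈ʳ pw θ∈Ξ
... | ψ , ψ∈Γ , θ∈ψ = ψ , there ψ∈Γ , θ∈ψ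

ResM-∈ : ∀ {Γ Ξ θ} → ResM Γ Ξ → θ ∈ Ξ → Σ Fm λ ψ → ψ ∈ Γ × θ ∈ Res ψ
ResM-∈ (_ , pw , Ξ↭Ξ₀) θ∈Ξ = Pointwise-∈ʳ pw (↭.∈-resp-↭ Ξ↭Ξ₀ θ∈Ξ)

ResM-++ : ∀ {Γ Δ Ξ Θ} → ResM Γ Ξ → ResM Δ Θ → ResM (Γ ++ Δ) (Ξ ++ Θ)
ResM-++ (Ξ₀ , pw , Ξ↭Ξ₀) (Θ₀ , pw′ , Θ↭Θ₀) = Ξ₀ ++ Θ₀ , Pointwise.++⁺ pw pw′ , ↭.++⁺ Ξ↭Ξ₀ Θ↭Θ₀

ResM-resp-↭ : ∀ {Γ Ξ Ξ′} → Ξ ↭ Ξ′ → ResM Γ Ξ′ → ResM Γ Ξ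
ResM-resp-↭ Ξ↭Ξ′ (Ξ₀ , pw , Ξ′↭Ξ₀) = Ξ₀ , pw , ↭-trans Ξ↭Ξ′ Ξ′↭Ξ₀

Traceable : Fm → List Fm → Set
Traceable φ T = Σ Fm λ ψ → ψ ∈ T × (PartialRes φ ψ ⊎ Σ Fm (λ ρ → ρ ∈ Res ψ × φ ≼ ρ))

AllTraceable : List Fm → List Fm → Set
AllTraceable S T = ∀ {θ} → θ ∈ S → Traceable θ T

AllTraceable-++ : ∀ {A B T U} → AllTraceable A T → AllTraceable B U → AllTraceable (A ++ B) (T ++ U)
AllTraceable-++ {A} {T = T} tA tB θ∈ with ∈-++⁻ A θ∈
... | inj₁ θ∈A = let ψ , ψ∈T , t = tA θ∈A in ψ , ∈-++⁺ˡ ψ∈T , t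
... | inj₂ θ∈B = let ψ , ψ∈U , t = tB θ∈B in ψ , ∈-++⁺ʳ T ψ∈U , t

resolution-traceable : ∀ {φ T Ξ} → ResM T Ξ → Sub φ Ξ → Traceable φ T
resolution-traceable r (θ , θ∈Ξ , φ≼θ) with ResM-∈ r θ∈Ξ
... | ψ , ψ∈T , θ∈ψ = ψ , ψ∈T , inj₂ (θ , θ∈ψ , φ≼θ)

AllPartialRes⁺ : List Fm → List Fm → Set
AllPartialRes⁺ S T = ∀ {θ} → θ ∈ S → Σ Fm λ ψ → ψ ∈ T × PartialRes⁺ θ ψ

AllPartialRes⁺-refl : ∀ {T} → AllPartialRes⁺ T T
AllPartialRes⁺-refl {θ = θ} θ∈T = θ , θ∈T , PartialRes⁺-refl θ

AllPartialRes⁺-resolve : ∀ {S S′ T φL φR} χ i → S′ ↭ plug χ (ior φL φR) ∷ S →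
  AllPartialRes⁺ S′ T → AllPartialRes⁺ (plug χ (pick i φL φR) ∷ S) T
AllPartialRes⁺-resolve χ i p prs (here refl) with prs (↭.∈-resp-↭ (↭-sym p) (here refl))
... | ψ , ψ∈T , pr = ψ , ψ∈T , PartialRes⁺-resolve χ i pr
AllPartialRes⁺-resolve χ i p prs (there θ∈S) = prs (↭.∈-resp-↭ (↭-sym p) (there θ∈S))

AllPartialRes⁺⇒AllTraceable : ∀ {S T} → AllPartialRes⁺ S T → AllTraceable S T
AllPartialRes⁺⇒AllTraceable prs θ∈S with prs θ∈S
... | ψ , ψ∈T , pr = ψ , ψ∈T , inj₁ (PartialRes⁺⇒PartialRes pr)

module _ (Γ₀ Δ₀ : List Fm) (f : List Fm → List Fm)
         (f-resolves : ∀ Ξ → ResM Γ₀ Ξ → ResM Δ₀ (f Ξ)) where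
  open NF Γ₀ Δ₀ f

  RBlock-traceable : ∀ {Ξ Θ φ} {d : Ξ ⊢ Θ} → RBlock d → ResM Γ₀ Ξ → AllPartialRes⁺ Θ Δ₀ →
                     Occurs φ d → Traceable φ (Γ₀ ++ Δ₀)
  RBlock-traceable {Ξ} (rstop d g Θ↭fΞ) r _ o =
    resolution-traceable (ResM-++ r (ResM-resp-↭ Θ↭fΞ (f-resolves Ξ r))) (G3-subformula d g o)
  RBlock-traceable (rstep _ _ _ _ _ _ _) r prs (inj₁ φ∈) =
    AllTraceable-++ (λ θ∈ → resolution-traceable r (_ , θ∈ , here)) (AllPartialRes⁺⇒AllTraceable prs) φ∈
  RBlock-traceable (rstep χ _ _ i _ p b) r prs (inj₂ o) =
    RBlock-traceable b r (AllPartialRes⁺-resolve χ i p prs) o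

  LBlock-traceable : ∀ {Γ φ} {d : Γ ⊢ Δ₀} → LBlock d → AllPartialRes⁺ Γ Γ₀ →
                     Occurs φ d → Traceable φ (Γ₀ ++ Δ₀)
  LBlock-traceable (lstop _ r b) _ o = RBlock-traceable b r AllPartialRes⁺-refl o
  LBlock-traceable (lstep _ _ _ _ _ _ _ _) prs (inj₁ φ∈) =
    AllTraceable-++ (AllPartialRes⁺⇒AllTraceable prs) (AllPartialRes⁺⇒AllTraceable AllPartialRes⁺-refl) φ∈
  LBlock-traceable (lstep χ _ _ _ _ p b _) prs (inj₂ (inj₁ o)) =
    LBlock-traceable b (AllPartialRes⁺-resolve χ L p prs) o
  LBlock-traceable (lstep χ _ _ _ _ p _ b) prs (inj₂ (inj₂ o)) =
    LBlock-traceable b (AllPartialRes⁺-resolve χ R p prs) o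

mainTheorem8 : (Γ Δ : List Fm) → All WF Γ → All WF Δ →
    (d : Γ ⊢ Δ) → NormalForm d →
    (φ : Fm) → Occurs φ d →
    Σ Fm (λ ψ → ψ ∈ Γ ++ Δ ×
      (PartialRes φ ψ ⊎ Σ Fm (λ ρ → ρ ∈ Res ψ × φ ≼ ρ)))
mainTheorem8 Γ Δ _ _ d (f , f-resolves , _ , nf) φ o =
  LBlock-traceable Γ Δ f f-resolves nf AllPartialRes⁺-refl o
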